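{- Let $q$ be a power of an odd prime and let $d_1,\dots,d_s$ be positive integers with $d_i\mid(q-1)$ for all $i$. Then $$I(d_1,\dots,d_s)=\frac{(-1)^s}{q-1}\sum_{m=1}^{q-1}\prod_{i:\,d_i\mid m}(1-d_i).$$
   Context: $I(d_1,\dots,d_s)$ denotes the number of $s$-tuples of integers $(y_1,\dots,y_s)$ with $1\le y_i\le d_i-1$ for all $i$ such that $\frac{y_1}{d_1}+\cdots+\frac{y_s}{d_s}\equiv 0\pmod 1$. An empty product equals $1$. -}

module Defs where

open import Data.Nat as ℕ using (ℕ; zero; suc; _∸_)
open import Data.Nat.Divisibility using (_∣?_)
open import Data.Integer as ℤ using (ℤ; +_)
open import Data.Rational as ℚ using (ℚ; _/_)
open import Data.Vec using (Vec; []; _∷_)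
open import Data.List using (List; []; _∷_; map; concatMap; filter; length; applyUpTo; foldr)
open import Relation.Nullary.Decidable using (does)
open import Data.Bool using (if_then_else_)

oneTo : ℕ → List ℕ
oneTo n = applyUpTo suc n

tuples : ∀ {s} → Vec ℕ s → List (Vec ℕ s)
tuples []       = [] ∷ []
tuples (d ∷ ds) = concatMap (λ y → map (y ∷_) (tuples ds)) (oneTo (d ∸ 1))

-- y / d as a rational (d = 0 never occurs for an actual tuple, since then
-- the range for y is empty; we set it to 0 for totality)
frac : ℕ → ℕ → ℚ
frac y zero    = ℚ.0ℚ
frac y (suc n) = (+ y) / suc n

fracSum : ∀ {s} → Vec ℕ s → Vec ℕ s → ℚ
fracSum []       []       = ℚ.0ℚ
fracSum (y ∷ ys) (d ∷ ds) = frac y d ℚ.+ fracSum ys ds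

-- a rational is ≡ 0 (mod 1) iff it is an integer iff its reduced denominator is 1
isIntegral? : (r : ℚ) → _
isIntegral? r = ℚ.↧ₙ r ℕ.≟ 1

I : ∀ {s} → Vec ℕ s → ℕ
I ds = length (filter (λ ys → isIntegral? (fracSum ys ds)) (tuples ds))

prodDiv : ∀ {s} → Vec ℕ s → ℕ → ℤ
prodDiv []       m = ℤ.1ℤ
prodDiv (d ∷ ds) m =
  (if does (d ∣? m) then (ℤ.1ℤ ℤ.- + d) else ℤ.1ℤ) ℤ.* prodDiv ds m

rhsSum : ∀ {s} → Vec ℕ s → ℕ → ℤ
rhsSum ds q = foldr ℤ._+_ ℤ.0ℤ (map (prodDiv ds) (oneTo (q ∸ 1)))

-- With ζ = exp (2πi / N), N = q − 1, orthogonality of characters gives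
-- I = (1/N) Σ_{m=1}^{N} Πᵢ Σ_{1≤y<dᵢ} ζ^{m y N/dᵢ}, and the inner sum is dᵢ − 1 or −1 according as
-- dᵢ ∣ m or not. Without complex numbers we prove, by induction on s, the version of this identity
-- that sums the number of solutions over a subgroup ⟨e⟩ of ℤ/N (SubgroupFormula). Adding a
-- coordinate (d₁, e₁) leads from ⟨e₀⟩ to ⟨e₀⟩ + ⟨e₁⟩ = ⟨gcd e₀ e₁⟩, the subgroup of order lcm d₀ d₁,
-- which (y₀ , y₁) ↦ y₀ e₀ + y₁ e₁ covers uniformly.
module Submission where

open import Data.Bool using (true; false; if_then_else_)
open import Data.Fin using (Fin; zero; suc)
open import Data.Integer using (ℤ; -[1+_]; 0ℤ; 1ℤ)
import Data.Integer as ℤ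
import Data.Integer.Properties as ℤ
open import Data.Integer.Tactic.RingSolver using (solve-∀)
open import Data.List using (List; []; _∷_; _++_; foldr; map; concatMap; filter; length; applyUpTo)
open import Data.List.Properties using (length-++; filter-++; filter-≐; map-applyUpTo)
open import Data.Nat as ℕ using (ℕ; zero; suc; _+_; _*_; _∸_; _^_; _<_; _≥_; s≤s; z≤n; NonZero)
open import Data.Nat.Divisibility
  using (_∣_; _∣?_; divides; quotient; _∣0; 1∣_; ∣-refl; ∣-trans; ∣-antisym; ∣m+n∣m⇒∣n; ∣m∣n⇒∣m+n; >⇒∤;
         *-monoʳ-∣; *-monoˡ-∣; *-cancelʳ-∣; m∣n⇒n≡quotient*m; m∣n⇒n≡m*quotient)
open import Data.Nat.GCD using (gcd; gcd-GCD; gcd-greatest; gcd[m,n]∣m; gcd[m,n]∣n; c*gcd[m,n]≡gcd[cm,cn]; module Bézout)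
open import Data.Nat.Primality using (Prime)
open import Data.Nat.Properties
  using (+-assoc; +-comm; +-identityʳ; +-suc; *-comm; *-assoc; *-identityˡ; *-distribʳ-+; *-cancelʳ-≡; *-monoˡ-<;
         m*n≢0; m*n≢0⇒m≢0; m*n≢0⇒n≢0)
open import Data.Nat.Tactic.RingSolver renaming (solve-∀ to ℕ-solve-∀)
open import Data.Product using (_×_; _,_; proj₁; proj₂)
open import Data.Rational as ℚ using (ℚ; _/_)
import Data.Rational.Properties as ℚ
open import Data.Rational.Unnormalised as ℚᵘ using (mkℚᵘ; *≡*)
import Data.Rational.Unnormalised.Properties as ℚᵘ
open import Data.Vec using (Vec; []; _∷_; lookup)
open import Data.Vec.Relation.Unary.All using (All; []; _∷_)
open import Function using (_∘_)
open import Function.Bundles using (_⇔_; mk⇔; Equivalence)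
open import Relation.Binary.PropositionalEquality
open import Relation.Nullary using (Dec; yes; no; ¬_; does; contradiction)
open import Relation.Nullary.Decidable using (dec-true; dec-false; does-⇔)
open import Relation.Unary using (Pred; Decidable)
open import Defs

open import Algebra.Properties.AbelianGroup ℤ.+-0-abelianGroup using (∙-cancelˡ)
open import Algebra.Properties.CommutativeSemigroup ℤ.+-commutativeSemigroup using (interchange)

-- Finite sums

∑< : ℕ → (ℕ → ℤ) → ℤ
∑< k f = foldr ℤ._+_ 0ℤ (applyUpTo f k)

syntax ∑< k (λ y → e) = ∑[ y < k ] e

∑-cong : ∀ k {f g : ℕ → ℤ} → (∀ y → f y ≡ g y) → ∑< k f ≡ ∑< k g
∑-cong zero    f≗g = refl
∑-cong (suc k) f≗g = cong₂ ℤ._+_ (f≗g 0) (∑-cong k (f≗g ∘ suc))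

∑-distrib-+ : ∀ k (f g : ℕ → ℤ) → ∑[ y < k ] (f y ℤ.+ g y) ≡ ∑< k f ℤ.+ ∑< k g
∑-distrib-+ zero    f g = refl
∑-distrib-+ (suc k) f g = begin
  (f 0 ℤ.+ g 0) ℤ.+ ∑[ y < k ] (f (suc y) ℤ.+ g (suc y))
    ≡⟨ cong (λ s → (f 0 ℤ.+ g 0) ℤ.+ s) (∑-distrib-+ k (f ∘ suc) (g ∘ suc)) ⟩
  (f 0 ℤ.+ g 0) ℤ.+ (∑< k (f ∘ suc) ℤ.+ ∑< k (g ∘ suc))
    ≡⟨ interchange (f 0) (g 0) _ _ ⟩
  (f 0 ℤ.+ ∑< k (f ∘ suc)) ℤ.+ (g 0 ℤ.+ ∑< k (g ∘ suc)) ∎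
  where open ≡-Reasoning

∑-distrib-- : ∀ k (f g : ℕ → ℤ) → ∑[ y < k ] (f y ℤ.- g y) ≡ ∑< k f ℤ.- ∑< k g
∑-distrib-- zero    f g = refl
∑-distrib-- (suc k) f g = begin
  (f 0 ℤ.- g 0) ℤ.+ ∑[ y < k ] (f (suc y) ℤ.- g (suc y))
    ≡⟨ cong (λ s → (f 0 ℤ.- g 0) ℤ.+ s) (∑-distrib-- k (f ∘ suc) (g ∘ suc)) ⟩
  (f 0 ℤ.- g 0) ℤ.+ (∑< k (f ∘ suc) ℤ.- ∑< k (g ∘ suc))
    ≡⟨ regroup (f 0) (g 0) _ _ ⟩
  (f 0 ℤ.+ ∑< k (f ∘ suc)) ℤ.- (g 0 ℤ.+ ∑< k (g ∘ suc)) ∎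
  where
  open ≡-Reasoning
  regroup : ∀ a b c d → (a ℤ.- b) ℤ.+ (c ℤ.- d) ≡ (a ℤ.+ c) ℤ.- (b ℤ.+ d)
  regroup = solve-∀

*-distribˡ-∑ : ∀ k c (f : ℕ → ℤ) → c ℤ.* ∑< k f ≡ ∑[ y < k ] (c ℤ.* f y)
*-distribˡ-∑ zero    c f = ℤ.*-zeroʳ c
*-distribˡ-∑ (suc k) c f = trans (ℤ.*-distribˡ-+ c (f 0) _) (cong (λ s → c ℤ.* f 0 ℤ.+ s) (*-distribˡ-∑ k c (f ∘ suc)))

∑-const : ∀ k c → ∑[ _ < k ] c ≡ ℤ.+ k ℤ.* c
∑-const zero    c = refl
∑-const (suc k) c = begin
  c ℤ.+ ∑[ _ < k ] c ≡⟨ cong (λ s → c ℤ.+ s) (∑-const k c) ⟩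
  c ℤ.+ ℤ.+ k ℤ.* c  ≡⟨ sym (ℤ.suc-* (ℤ.+ k) c) ⟩
  ℤ.+ suc k ℤ.* c      ∎
  where open ≡-Reasoning

∑-vanishing-tail : ∀ k (f : ℕ → ℤ) → (∀ y → y < k → f (suc y) ≡ 0ℤ) → ∑< (suc k) f ≡ f 0
∑-vanishing-tail k f vanish = begin
  f 0 ℤ.+ ∑< k (f ∘ suc)      ≡⟨ cong (λ s → f 0 ℤ.+ s) (∑-vanish k (f ∘ suc) vanish) ⟩
  f 0 ℤ.+ 0ℤ                  ≡⟨ ℤ.+-identityʳ (f 0) ⟩
  f 0                         ∎
  where
  open ≡-Reasoning
  ∑-vanish : ∀ k (g : ℕ → ℤ) → (∀ y → y < k → g y ≡ 0ℤ) → ∑< k g ≡ 0ℤ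
  ∑-vanish zero    g _ = refl
  ∑-vanish (suc k) g vanish =
    cong₂ ℤ._+_ (vanish 0 (s≤s z≤n)) (∑-vanish k (g ∘ suc) (λ y y<k → vanish (suc y) (s≤s y<k)))

∑-comm : ∀ a b (f : ℕ → ℕ → ℤ) → ∑[ i < a ] ∑[ j < b ] f i j ≡ ∑[ j < b ] ∑[ i < a ] f i j
∑-comm zero    b f = sym (trans (∑-const b 0ℤ) (ℤ.*-zeroʳ (ℤ.+ b)))
∑-comm (suc a) b f = begin
  ∑[ j < b ] f 0 j ℤ.+ ∑[ i < a ] ∑[ j < b ] f (suc i) j
    ≡⟨ cong (λ s → ∑[ j < b ] f 0 j ℤ.+ s) (∑-comm a b (f ∘ suc)) ⟩
  ∑[ j < b ] f 0 j ℤ.+ ∑[ j < b ] ∑[ i < a ] f (suc i) j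
    ≡⟨ sym (∑-distrib-+ b (f 0) (λ j → ∑[ i < a ] f (suc i) j)) ⟩
  ∑[ j < b ] (f 0 j ℤ.+ ∑[ i < a ] f (suc i) j) ∎
  where open ≡-Reasoning

∑-split : ∀ a b (f : ℕ → ℤ) → ∑< (a + b) f ≡ ∑< a f ℤ.+ ∑[ j < b ] f (a + j)
∑-split zero    b f = sym (ℤ.+-identityˡ _)
∑-split (suc a) b f = trans (cong (λ s → f 0 ℤ.+ s) (∑-split a b (f ∘ suc))) (sym (ℤ.+-assoc (f 0) _ _))

∑-init-last : ∀ k (f : ℕ → ℤ) → ∑< (suc k) f ≡ ∑< k f ℤ.+ f k
∑-init-last k f = begin
  ∑< (suc k) f                   ≡⟨ cong (λ n → ∑< n f) (+-comm 1 k) ⟩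
  ∑< (k + 1) f                   ≡⟨ ∑-split k 1 f ⟩
  ∑< k f ℤ.+ (f (k + 0) ℤ.+ 0ℤ)  ≡⟨ cong (λ s → ∑< k f ℤ.+ s) (trans (ℤ.+-identityʳ _) (cong f (+-identityʳ k))) ⟩
  ∑< k f ℤ.+ f k                 ∎
  where open ≡-Reasoning

∑-rotate : ∀ k (f : ℕ → ℤ) → f k ≡ f 0 → ∑[ y < k ] f (suc y) ≡ ∑< k f
∑-rotate k f fk≡f0 = ∙-cancelˡ (f 0) _ _ (begin
  f 0 ℤ.+ ∑[ y < k ] f (suc y) ≡⟨ ∑-init-last k f ⟩
  ∑< k f ℤ.+ f k               ≡⟨ cong (λ s → ∑< k f ℤ.+ s) fk≡f0 ⟩
  ∑< k f ℤ.+ f 0               ≡⟨ ℤ.+-comm _ (f 0) ⟩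
  f 0 ℤ.+ ∑< k f               ∎)
  where open ≡-Reasoning

∑-progression-head : ∀ d e (f : ℕ → ℤ) x .{{_ : NonZero d}} →
  ∑[ y < d ] f (x + y * e) ≡ f x ℤ.+ ∑[ y < d ∸ 1 ] f (x + suc y * e)
∑-progression-head (suc d) e f x = cong (λ t → f t ℤ.+ ∑[ y < d ] f (x + suc y * e)) (+-identityʳ x)

-- Periodic functions

Periodic : ℕ → (ℕ → ℤ) → Set
Periodic p f = ∀ x → f (x + p) ≡ f x

periodic-shift : ∀ {p} {f : ℕ → ℤ} → Periodic p f → ∀ c → Periodic p (λ w → f (w + c))
periodic-shift {p} {f} per c w = begin
  f (w + p + c) ≡⟨ cong f (trans (+-assoc w p c) (trans (cong (w +_) (+-comm p c)) (sym (+-assoc w c p)))) ⟩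
  f (w + c + p) ≡⟨ per (w + c) ⟩
  f (w + c)     ∎
  where open ≡-Reasoning

periodic-multiple : ∀ {p} {f : ℕ → ℤ} → Periodic p f → ∀ k → Periodic (k * p) f
periodic-multiple {f = f} per zero    x = cong f (+-identityʳ x)
periodic-multiple {p} {f} per (suc k) x = begin
  f (x + (p + k * p)) ≡⟨ cong f (sym (+-assoc x p (k * p))) ⟩
  f (x + p + k * p)   ≡⟨ periodic-multiple per k (x + p) ⟩
  f (x + p)           ≡⟨ per x ⟩
  f x                 ∎
  where open ≡-Reasoning

periodic-gcd : ∀ {a b} {f : ℕ → ℤ} → Periodic a f → Periodic b f → Periodic (gcd a b) f
periodic-gcd {a} {b} {f} per-a per-b w with Bézout.identity (gcd-GCD a b)
... | Bézout.+- x y eq = begin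
  f (w + gcd a b)             ≡⟨ periodic-multiple per-b y (w + gcd a b) ⟨
  f (w + gcd a b + y * b)     ≡⟨ cong f (trans (+-assoc w _ _) (cong (w +_) eq)) ⟩
  f (w + x * a)               ≡⟨ periodic-multiple per-a x w ⟩
  f w                         ∎
  where open ≡-Reasoning
... | Bézout.-+ x y eq = begin
  f (w + gcd a b)             ≡⟨ periodic-multiple per-a x (w + gcd a b) ⟨
  f (w + gcd a b + x * a)     ≡⟨ cong f (trans (+-assoc w _ _) (cong (w +_) eq)) ⟩
  f (w + y * b)               ≡⟨ periodic-multiple per-b y w ⟩
  f w                         ∎
  where open ≡-Reasoning

∑-shift : ∀ k {f : ℕ → ℤ} → Periodic k f → ∀ c → ∑[ z < k ] f (z + c) ≡ ∑< k f
∑-shift k {f} per zero    = ∑-cong k (λ z → cong f (+-identityʳ z))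
∑-shift k {f} per (suc c) = begin
  ∑[ z < k ] f (z + suc c)   ≡⟨ ∑-cong k (λ z → cong f (+-suc z c)) ⟩
  ∑[ z < k ] f (suc z + c)   ≡⟨ ∑-rotate k (λ z → f (z + c)) (trans (cong f (+-comm k c)) (per c)) ⟩
  ∑[ z < k ] f (z + c)       ≡⟨ ∑-shift k per c ⟩
  ∑< k f                     ∎
  where open ≡-Reasoning

∑-periodic : ∀ d {f : ℕ → ℤ} → Periodic d f → ∀ k → ∑< (k * d) f ≡ ℤ.+ k ℤ.* ∑< d f
∑-periodic d {f} per zero    = refl
∑-periodic d {f} per (suc k) = begin
  ∑< (d + k * d) f                      ≡⟨ ∑-split d (k * d) f ⟩
  ∑< d f ℤ.+ ∑[ j < k * d ] f (d + j)   ≡⟨ cong (λ s → ∑< d f ℤ.+ s) (∑-cong (k * d) per′) ⟩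
  ∑< d f ℤ.+ ∑< (k * d) f               ≡⟨ cong (λ s → ∑< d f ℤ.+ s) (∑-periodic d per k) ⟩
  ∑< d f ℤ.+ ℤ.+ k ℤ.* ∑< d f           ≡⟨ ℤ.suc-* (ℤ.+ k) _ ⟨
  ℤ.+ suc k ℤ.* ∑< d f                  ∎
  where
  open ≡-Reasoning
  per′ : ∀ j → f (d + j) ≡ f j
  per′ j = trans (cong f (+-comm d j)) (per j)

periodic-∑-progression : ∀ d e {f : ℕ → ℤ} → Periodic (d * e) f → Periodic e (λ w → ∑[ y < d ] f (w + y * e))
periodic-∑-progression d e {f} per w = begin
  ∑[ y < d ] f (w + e + y * e)    ≡⟨ ∑-cong d (λ y → cong f (+-assoc w e (y * e))) ⟩
  ∑[ y < d ] f (w + suc y * e)    ≡⟨ ∑-rotate d (λ y → f (w + y * e)) (trans (per w) (cong f (sym (+-identityʳ w)))) ⟩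
  ∑[ y < d ] f (w + y * e)        ∎
  where open ≡-Reasoning

periodic-∣? : ∀ d (a b : ℤ) → Periodic d (λ x → if does (d ∣? x) then a else b)
periodic-∣? d a b x = cong (if_then a else b) (does-⇔ ∣x+d⇔∣x (d ∣? (x + d)) (d ∣? x))
  where
  ∣x+d⇔∣x : d ∣ x + d ⇔ d ∣ x
  ∣x+d⇔∣x = mk⇔
    (λ d∣x+d → ∣m+n∣m⇒∣n (subst (d ∣_) (+-comm x d) d∣x+d) ∣-refl)
    (λ d∣x → ∣m∣n⇒∣m+n d∣x ∣-refl)

-- Divisors of N and subgroup sums

nonZero-factorˡ : ∀ {d e N} .{{_ : NonZero N}} → d * e ≡ N → NonZero d
nonZero-factorˡ {d} refl = m*n≢0⇒m≢0 d

nonZero-factorʳ : ∀ {d e N} .{{_ : NonZero N}} → d * e ≡ N → NonZero e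
nonZero-factorʳ {d} refl = m*n≢0⇒n≢0 d

∣⇔∣-cofactor : ∀ {d e N m} .{{_ : NonZero N}} → d * e ≡ N → d ∣ m ⇔ N ∣ m * e
∣⇔∣-cofactor {d} {e} refl = mk⇔ (*-monoˡ-∣ e) (*-cancelʳ-∣ e {{m*n≢0⇒n≢0 d}})

∣-*-gcd : ∀ m {a b c} → c ∣ m * a → c ∣ m * b → c ∣ m * gcd a b
∣-*-gcd m {a} {b} {c} c∣ma c∣mb = subst (c ∣_) (sym (c*gcd[m,n]≡gcd[cm,cn] m a b)) (gcd-greatest c∣ma c∣mb)

∣⇔∣×∣-cofactors : ∀ {N d₀ e₀ d₁ e₁ l m} .{{_ : NonZero N}} →
  d₀ * e₀ ≡ N → d₁ * e₁ ≡ N → l * gcd e₀ e₁ ≡ N → l ∣ m ⇔ (d₀ ∣ m × d₁ ∣ m)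
∣⇔∣×∣-cofactors {N} {d₀} {e₀} {d₁} {e₁} {l} {m} h₀ h₁ hₗ = mk⇔
  (λ l∣m → let N∣mE = to (∣⇔∣-cofactor hₗ) l∣m in
    from (∣⇔∣-cofactor h₀) (∣-trans N∣mE (*-monoʳ-∣ m (gcd[m,n]∣m e₀ e₁))) ,
    from (∣⇔∣-cofactor h₁) (∣-trans N∣mE (*-monoʳ-∣ m (gcd[m,n]∣n e₀ e₁))))
  (λ (d₀∣m , d₁∣m) → from (∣⇔∣-cofactor hₗ)
    (∣-*-gcd m (to (∣⇔∣-cofactor h₀) d₀∣m) (to (∣⇔∣-cofactor h₁) d₁∣m)))
  where open Equivalence

-- subgroupSum d m = Σ_{y<d} exp (2πi m y / d).
subgroupSum : ℕ → ℕ → ℤ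
subgroupSum d m = if does (d ∣? m) then ℤ.+ d else 0ℤ

subgroupSum-∣ : ∀ {d m} → d ∣ m → subgroupSum d m ≡ ℤ.+ d
subgroupSum-∣ {d} {m} d∣m = cong (if_then ℤ.+ d else 0ℤ) (dec-true (d ∣? m) d∣m)

subgroupSum-∤ : ∀ {d m} → ¬ d ∣ m → subgroupSum d m ≡ 0ℤ
subgroupSum-∤ {d} {m} d∤m = cong (if_then ℤ.+ d else 0ℤ) (dec-false (d ∣? m) d∤m)

subgroupSum-lcm : ∀ {d₀ d₁ l m} → l ∣ m ⇔ (d₀ ∣ m × d₁ ∣ m) →
  ℤ.+ l ℤ.* (subgroupSum d₀ m ℤ.* subgroupSum d₁ m) ≡ ℤ.+ d₀ ℤ.* ℤ.+ d₁ ℤ.* subgroupSum l m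
subgroupSum-lcm {d₀} {d₁} {l} {m} l∣m⇔ = by-cases (d₀ ∣? m) (d₁ ∣? m)
  where
  open Equivalence l∣m⇔
  D = ℤ.+ d₀ ℤ.* ℤ.+ d₁
  both-zero : ℤ.+ l ℤ.* 0ℤ ≡ D ℤ.* 0ℤ
  both-zero = trans (ℤ.*-zeroʳ (ℤ.+ l)) (sym (ℤ.*-zeroʳ D))
  by-cases : Dec (d₀ ∣ m) → Dec (d₁ ∣ m) →
    ℤ.+ l ℤ.* (subgroupSum d₀ m ℤ.* subgroupSum d₁ m) ≡ D ℤ.* subgroupSum l m
  by-cases (yes d₀∣m) (yes d₁∣m)
    rewrite subgroupSum-∣ d₀∣m | subgroupSum-∣ d₁∣m | subgroupSum-∣ (from (d₀∣m , d₁∣m)) = ℤ.*-comm (ℤ.+ l) D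
  by-cases (no d₀∤m) _
    rewrite subgroupSum-∤ d₀∤m | subgroupSum-∤ (d₀∤m ∘ proj₁ ∘ to) = both-zero
  by-cases (yes _) (no d₁∤m)
    rewrite subgroupSum-∤ d₁∤m | subgroupSum-∤ (d₁∤m ∘ proj₂ ∘ to) | ℤ.*-zeroʳ (subgroupSum d₀ m) = both-zero

∑-subgroupSum : ∀ {d e N} .{{_ : NonZero N}} → d * e ≡ N → ∑[ m < N ] subgroupSum d (suc m) ≡ ℤ.+ N
∑-subgroupSum {d} {e} {N} h = begin
  ∑[ m < N ] subgroupSum d (suc m)  ≡⟨ ∑-rotate N (subgroupSum d) β[N]≡β[0] ⟩
  ∑< N (subgroupSum d)             ≡⟨ cong (λ n → ∑< n (subgroupSum d)) N≡e*d ⟩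
  ∑< (e * d) (subgroupSum d)       ≡⟨ ∑-periodic d (periodic-∣? d (ℤ.+ d) 0ℤ) e ⟩
  ℤ.+ e ℤ.* ∑< d (subgroupSum d)   ≡⟨ cong (ℤ.+ e ℤ.*_) (∑-one-period d {{nonZero-factorˡ {d} {e} h}}) ⟩
  ℤ.+ e ℤ.* ℤ.+ d                  ≡⟨ ℤ.pos-* e d ⟨
  ℤ.+ (e * d)                      ≡⟨ cong ℤ.+_ N≡e*d ⟨
  ℤ.+ N                            ∎
  where
  open ≡-Reasoning
  N≡e*d : N ≡ e * d
  N≡e*d = trans (sym h) (*-comm d e)
  β[N]≡β[0] : subgroupSum d N ≡ subgroupSum d 0
  β[N]≡β[0] = trans (subgroupSum-∣ (divides e N≡e*d)) (sym (subgroupSum-∣ (d ∣0)))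
  ∑-one-period : ∀ d .{{_ : NonZero d}} → ∑< d (subgroupSum d) ≡ ℤ.+ d
  ∑-one-period (suc k) = trans
    (∑-vanishing-tail k (subgroupSum (suc k)) (λ y y<k → subgroupSum-∤ (>⇒∤ {suc y} (s≤s y<k))))
    (subgroupSum-∣ (suc k ∣0))

-- T w = Σ F (w + y₀ e₀ + y₁ e₁) has periods e₀ and e₁, hence gcd e₀ e₁; averaging T 0 over the
-- l multiples of gcd e₀ e₁ and exchanging the sums turns every inner sum into a translate of S.
∑-sumset : ∀ {N d₀ e₀ d₁ e₁ l} {F : ℕ → ℤ} → Periodic N F →
  d₀ * e₀ ≡ N → d₁ * e₁ ≡ N → l * gcd e₀ e₁ ≡ N →
  ℤ.+ l ℤ.* ∑[ y₀ < d₀ ] ∑[ y₁ < d₁ ] F (y₀ * e₀ + y₁ * e₁)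
    ≡ ℤ.+ d₀ ℤ.* (ℤ.+ d₁ ℤ.* ∑[ z < l ] F (z * gcd e₀ e₁))
∑-sumset {N} {d₀} {e₀} {d₁} {e₁} {l} {F} per h₀ h₁ hₗ = begin
  ℤ.+ l ℤ.* T 0
    ≡⟨ ∑-const l (T 0) ⟨
  ∑[ z < l ] T 0
    ≡⟨ ∑-cong l (λ z → periodic-multiple T-periodic z 0) ⟨
  ∑[ z < l ] ∑[ y₀ < d₀ ] ∑[ y₁ < d₁ ] F (z * E + y₀ * e₀ + y₁ * e₁)
    ≡⟨ ∑-comm l d₀ _ ⟩
  ∑[ y₀ < d₀ ] ∑[ z < l ] ∑[ y₁ < d₁ ] F (z * E + y₀ * e₀ + y₁ * e₁)
    ≡⟨ ∑-cong d₀ (λ y₀ → ∑-comm l d₁ _) ⟩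
  ∑[ y₀ < d₀ ] ∑[ y₁ < d₁ ] ∑[ z < l ] F (z * E + y₀ * e₀ + y₁ * e₁)
    ≡⟨ ∑-cong d₀ (λ y₀ → ∑-cong d₁ (∑-translate y₀)) ⟩
  ∑[ y₀ < d₀ ] ∑[ y₁ < d₁ ] S
    ≡⟨ ∑-cong d₀ (λ _ → ∑-const d₁ S) ⟩
  ∑[ y₀ < d₀ ] (ℤ.+ d₁ ℤ.* S)
    ≡⟨ ∑-const d₀ _ ⟩
  ℤ.+ d₀ ℤ.* (ℤ.+ d₁ ℤ.* S)
    ∎
  where
  open ≡-Reasoning
  E = gcd e₀ e₁
  S = ∑[ z < l ] F (z * E)
  G : ℕ → ℤ
  G w = ∑[ y₁ < d₁ ] F (w + y₁ * e₁)
  T : ℕ → ℤ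
  T w = ∑[ y₀ < d₀ ] G (w + y₀ * e₀)

  periodic-cast : ∀ {p q} {f : ℕ → ℤ} → p ≡ q → Periodic q f → Periodic p f
  periodic-cast refl per = per

  G-periodic-N : Periodic N G
  G-periodic-N w = ∑-cong d₁ (λ y₁ → periodic-shift per (y₁ * e₁) w)

  G-periodic-e₁ : Periodic e₁ G
  G-periodic-e₁ = periodic-∑-progression d₁ e₁ (periodic-cast h₁ per)

  T-periodic : Periodic E T
  T-periodic = periodic-gcd
    (periodic-∑-progression d₀ e₀ (periodic-cast h₀ G-periodic-N))
    (λ w → ∑-cong d₀ (λ y₀ → periodic-shift G-periodic-e₁ (y₀ * e₀) w))

  u = quotient (gcd[m,n]∣m e₀ e₁)
  v = quotient (gcd[m,n]∣n e₀ e₁)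
  e₀≡u*E = m∣n⇒n≡quotient*m (gcd[m,n]∣m e₀ e₁)
  e₁≡v*E = m∣n⇒n≡quotient*m (gcd[m,n]∣n e₀ e₁)

  F∘*E-periodic : Periodic l (λ z → F (z * E))
  F∘*E-periodic z = trans (cong F (trans (*-distribʳ-+ E z l) (cong (z * E +_) hₗ))) (per (z * E))

  ∑-translate : ∀ y₀ y₁ → ∑[ z < l ] F (z * E + y₀ * e₀ + y₁ * e₁) ≡ S
  ∑-translate y₀ y₁ = begin
    ∑[ z < l ] F (z * E + y₀ * e₀ + y₁ * e₁)   ≡⟨ ∑-cong l (λ z → cong F (collect z)) ⟩
    ∑[ z < l ] F ((z + (y₀ * u + y₁ * v)) * E) ≡⟨ ∑-shift l F∘*E-periodic (y₀ * u + y₁ * v) ⟩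
    S                                           ∎
    where
    factor : ∀ z y₀ y₁ u v E → z * E + y₀ * (u * E) + y₁ * (v * E) ≡ (z + (y₀ * u + y₁ * v)) * E
    factor = ℕ-solve-∀
    collect : ∀ z → z * E + y₀ * e₀ + y₁ * e₁ ≡ (z + (y₀ * u + y₁ * v)) * E
    collect z = trans (cong₂ (λ a b → z * E + y₀ * a + y₁ * b) e₀≡u*E e₁≡v*E) (factor z y₀ y₁ u v E)

module Solutions (N : ℕ) .{{_ : NonZero N}} where

  Complementary : ℕ × ℕ → Set
  Complementary (d , e) = d * e ≡ N

  -- A pair (d , e) has d e = N, so y / d = y e / N: solutions des t counts the tuples
  -- 1 ≤ yᵢ < dᵢ with N ∣ t + Σ yᵢ eᵢ.
  solutions : ∀ {s} → Vec (ℕ × ℕ) s → ℕ → ℤ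
  solutions []              t = if does (N ∣? t) then 1ℤ else 0ℤ
  solutions ((d , e) ∷ des) t = ∑[ y < d ∸ 1 ] solutions des (t + suc y * e)

  characterSum : ∀ {s} → Vec (ℕ × ℕ) s → ℕ → ℤ
  characterSum []              m = 1ℤ
  characterSum ((d , _) ∷ des) m = (subgroupSum d m ℤ.- 1ℤ) ℤ.* characterSum des m

  SubgroupFormula : ∀ {s} → Vec (ℕ × ℕ) s → Set
  SubgroupFormula des = ∀ d e → d * e ≡ N →
    ℤ.+ N ℤ.* ∑[ y < d ] solutions des (y * e) ≡ ∑[ m < N ] (subgroupSum d (suc m) ℤ.* characterSum des (suc m))

  solutions-periodic : ∀ {s} (des : Vec (ℕ × ℕ) s) → Periodic N (solutions des)
  solutions-periodic []              = periodic-∣? N 1ℤ 0ℤ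
  solutions-periodic ((d , e) ∷ des) t = ∑-cong (d ∸ 1) (λ y → periodic-shift (solutions-periodic des) (suc y * e) t)

  ∑-solutions-[] : ∀ d e .{{_ : NonZero d}} → d * e ≡ N → ∑[ y < d ] solutions [] (y * e) ≡ 1ℤ
  ∑-solutions-[] (suc k) e h = trans
    (∑-vanishing-tail k (λ y → solutions [] (y * e)) (λ y y<k →
      cong (if_then 1ℤ else 0ℤ) (dec-false (N ∣? (suc y * e)) (>⇒∤ {{m*n≢0 (suc y) e}} (suc-y*e<N y<k)))))
    (cong (if_then 1ℤ else 0ℤ) (dec-true (N ∣? 0) (N ∣0)))
    where
    instance _ = nonZero-factorʳ {suc k} h
    suc-y*e<N : ∀ {y} → y < k → suc y * e < N
    suc-y*e<N y<k = subst (_ <_) h (*-monoˡ-< e (s≤s y<k))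

  subgroupFormula-[] : SubgroupFormula []
  subgroupFormula-[] d e h = begin
    ℤ.+ N ℤ.* ∑[ y < d ] solutions [] (y * e)      ≡⟨ cong (ℤ.+ N ℤ.*_) (∑-solutions-[] d e {{nonZero-factorˡ h}} h) ⟩
    ℤ.+ N ℤ.* 1ℤ                                   ≡⟨ ℤ.*-identityʳ (ℤ.+ N) ⟩
    ℤ.+ N                                          ≡⟨ ∑-subgroupSum h ⟨
    ∑[ m < N ] subgroupSum d (suc m)               ≡⟨ ∑-cong N (λ m → ℤ.*-identityʳ (subgroupSum d (suc m))) ⟨
    ∑[ m < N ] (subgroupSum d (suc m) ℤ.* 1ℤ)      ∎
    where open ≡-Reasoning

  subgroupFormula-∷ : ∀ {s} d₁ e₁ (des : Vec (ℕ × ℕ) s) → d₁ * e₁ ≡ N →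
    SubgroupFormula des → SubgroupFormula ((d₁ , e₁) ∷ des)
  subgroupFormula-∷ d₁ e₁ des h₁ formula d₀ e₀ h₀ =
    ℤ.*-cancelˡ-≡ (ℤ.+ l) _ _ {{nonZero-factorˡ hₗ}} (trans scaled-lhs (sym scaled-rhs))
    where
    open ≡-Reasoning
    E = gcd e₀ e₁
    l = d₀ * quotient (gcd[m,n]∣m e₀ e₁)
    hₗ : l * E ≡ N
    hₗ = trans (*-assoc d₀ _ E) (trans (cong (d₀ *_) (sym (m∣n⇒n≡quotient*m (gcd[m,n]∣m e₀ e₁)))) h₀)
    L = ℤ.+ l
    D = ℤ.+ d₀ ℤ.* ℤ.+ d₁
    F = solutions des
    P = ∑[ y < d₀ ] F (y * e₀)
    Q = ∑[ y < d₀ ] solutions ((d₁ , e₁) ∷ des) (y * e₀)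
    S = ∑[ z < l ] F (z * E)
    A = characterSum des
    X = ∑[ m < N ] (subgroupSum d₀ (suc m) ℤ.* A (suc m))
    Y = ∑[ m < N ] (subgroupSum l (suc m) ℤ.* A (suc m))

    T = ∑[ y₀ < d₀ ] ∑[ y₁ < d₁ ] F (y₀ * e₀ + y₁ * e₁)

    split : T ≡ P ℤ.+ Q
    split = trans
      (∑-cong d₀ (λ y₀ → ∑-progression-head d₁ e₁ F (y₀ * e₀) {{nonZero-factorˡ h₁}}))
      (∑-distrib-+ d₀ (λ y₀ → F (y₀ * e₀)) (λ y₀ → solutions ((d₁ , e₁) ∷ des) (y₀ * e₀)))

    scaled-lhs : L ℤ.* (ℤ.+ N ℤ.* Q) ≡ D ℤ.* Y ℤ.- L ℤ.* X
    scaled-lhs = begin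
      L ℤ.* (ℤ.+ N ℤ.* Q)
        ≡⟨ rearrange L (ℤ.+ N) P Q ⟩
      ℤ.+ N ℤ.* (L ℤ.* (P ℤ.+ Q)) ℤ.- L ℤ.* (ℤ.+ N ℤ.* P)
        ≡⟨ cong₂ (λ a b → ℤ.+ N ℤ.* (L ℤ.* a) ℤ.- L ℤ.* b) (sym split) (formula d₀ e₀ h₀) ⟩
      ℤ.+ N ℤ.* (L ℤ.* T) ℤ.- L ℤ.* X
        ≡⟨ cong (λ a → ℤ.+ N ℤ.* a ℤ.- L ℤ.* X) (∑-sumset {N} {d₀} {e₀} {d₁} {e₁} {l} (solutions-periodic des) h₀ h₁ hₗ) ⟩
      ℤ.+ N ℤ.* (ℤ.+ d₀ ℤ.* (ℤ.+ d₁ ℤ.* S)) ℤ.- L ℤ.* X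
        ≡⟨ cong (ℤ._- L ℤ.* X) (reassociate (ℤ.+ N) (ℤ.+ d₀) (ℤ.+ d₁) S) ⟩
      D ℤ.* (ℤ.+ N ℤ.* S) ℤ.- L ℤ.* X
        ≡⟨ cong (λ a → D ℤ.* a ℤ.- L ℤ.* X) (formula l E hₗ) ⟩
      D ℤ.* Y ℤ.- L ℤ.* X
        ∎
      where
      rearrange : ∀ L n P Q → L ℤ.* (n ℤ.* Q) ≡ n ℤ.* (L ℤ.* (P ℤ.+ Q)) ℤ.- L ℤ.* (n ℤ.* P)
      rearrange = solve-∀
      reassociate : ∀ n a b c → n ℤ.* (a ℤ.* (b ℤ.* c)) ≡ a ℤ.* b ℤ.* (n ℤ.* c)
      reassociate = solve-∀

    scaled-rhs :
      L ℤ.* ∑[ m < N ] (subgroupSum d₀ (suc m) ℤ.* characterSum ((d₁ , e₁) ∷ des) (suc m)) ≡ D ℤ.* Y ℤ.- L ℤ.* X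
    scaled-rhs = begin
      L ℤ.* ∑[ m < N ] (subgroupSum d₀ (suc m) ℤ.* characterSum ((d₁ , e₁) ∷ des) (suc m))
        ≡⟨ *-distribˡ-∑ N L _ ⟩
      ∑[ m < N ] (L ℤ.* (subgroupSum d₀ (suc m) ℤ.* ((subgroupSum d₁ (suc m) ℤ.- 1ℤ) ℤ.* A (suc m))))
        ≡⟨ ∑-cong N (λ m → termwise (suc m)) ⟩
      ∑[ m < N ] (D ℤ.* (subgroupSum l (suc m) ℤ.* A (suc m)) ℤ.- L ℤ.* (subgroupSum d₀ (suc m) ℤ.* A (suc m)))
        ≡⟨ ∑-distrib-- N _ _ ⟩
      ∑[ m < N ] (D ℤ.* (subgroupSum l (suc m) ℤ.* A (suc m))) ℤ.- ∑[ m < N ] (L ℤ.* (subgroupSum d₀ (suc m) ℤ.* A (suc m)))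
        ≡⟨ cong₂ ℤ._-_ (*-distribˡ-∑ N D _) (*-distribˡ-∑ N L _) ⟨
      D ℤ.* Y ℤ.- L ℤ.* X
        ∎
      where
      lcm : ∀ {m} → l ∣ m ⇔ (d₀ ∣ m × d₁ ∣ m)
      lcm = ∣⇔∣×∣-cofactors h₀ h₁ hₗ
      expand : ∀ L a b c → L ℤ.* (a ℤ.* ((b ℤ.- 1ℤ) ℤ.* c)) ≡ L ℤ.* (a ℤ.* b) ℤ.* c ℤ.- L ℤ.* (a ℤ.* c)
      expand = solve-∀
      termwise : ∀ m → L ℤ.* (subgroupSum d₀ m ℤ.* ((subgroupSum d₁ m ℤ.- 1ℤ) ℤ.* A m))
                     ≡ D ℤ.* (subgroupSum l m ℤ.* A m) ℤ.- L ℤ.* (subgroupSum d₀ m ℤ.* A m)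
      termwise m = begin
        L ℤ.* (subgroupSum d₀ m ℤ.* ((subgroupSum d₁ m ℤ.- 1ℤ) ℤ.* A m))
          ≡⟨ expand L (subgroupSum d₀ m) (subgroupSum d₁ m) (A m) ⟩
        L ℤ.* (subgroupSum d₀ m ℤ.* subgroupSum d₁ m) ℤ.* A m ℤ.- L ℤ.* (subgroupSum d₀ m ℤ.* A m)
          ≡⟨ cong (λ a → a ℤ.* A m ℤ.- L ℤ.* (subgroupSum d₀ m ℤ.* A m)) (subgroupSum-lcm {d₀} {d₁} {l} {m} lcm) ⟩
        D ℤ.* subgroupSum l m ℤ.* A m ℤ.- L ℤ.* (subgroupSum d₀ m ℤ.* A m)
          ≡⟨ cong (ℤ._- L ℤ.* (subgroupSum d₀ m ℤ.* A m)) (ℤ.*-assoc D _ (A m)) ⟩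
        D ℤ.* (subgroupSum l m ℤ.* A m) ℤ.- L ℤ.* (subgroupSum d₀ m ℤ.* A m)
          ∎

  subgroupFormula : ∀ {s} (des : Vec (ℕ × ℕ) s) → All Complementary des → SubgroupFormula des
  subgroupFormula []              []       = subgroupFormula-[]
  subgroupFormula ((d , e) ∷ des) (h ∷ hs) = subgroupFormula-∷ d e des h (subgroupFormula des hs)

/-cross : ∀ a b m n .{{_ : NonZero m}} .{{_ : NonZero n}} → a ℤ.* ℤ.+ n ≡ b ℤ.* ℤ.+ m → a / m ≡ b / n
/-cross a b (suc m) (suc n) eq = ℚ.fromℚᵘ-cong {mkℚᵘ a m} {mkℚᵘ b n} (*≡* eq)

/-+ : ∀ a b m n .{{_ : NonZero m}} .{{_ : NonZero n}} →
  ℤ.+ a / m ℚ.+ ℤ.+ b / n ≡ _/_ (ℤ.+ (a * n + b * m)) (m * n) {{m*n≢0 m n}}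
/-+ a b (suc m) (suc n) = ℚ.toℚᵘ-injective (ℚᵘ.≃-trans (ℚ.toℚᵘ-homo-+ (ℤ.+ a / suc m) (ℤ.+ b / suc n))
  (ℚᵘ.≃-trans (ℚᵘ.+-cong (ℚ.toℚᵘ-fromℚᵘ (mkℚᵘ (ℤ.+ a) m)) (ℚ.toℚᵘ-fromℚᵘ (mkℚᵘ (ℤ.+ b) n)))
    (ℚᵘ.≃-trans (ℚᵘ.≃-reflexive (cong (λ x → mkℚᵘ x (ℕ.pred (suc m * suc n))) numerator))
      (ℚᵘ.≃-sym (ℚ.toℚᵘ-fromℚᵘ (mkℚᵘ (ℤ.+ (a * suc n + b * suc m)) (ℕ.pred (suc m * suc n))))))))
  where
  numerator : ℤ.+ a ℤ.* ℤ.+ suc n ℤ.+ ℤ.+ b ℤ.* ℤ.+ suc m ≡ ℤ.+ (a * suc n + b * suc m)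
  numerator = trans (sym (cong₂ ℤ._+_ (ℤ.pos-* a (suc n)) (ℤ.pos-* b (suc m)))) (sym (ℤ.pos-+ (a * suc n) (b * suc m)))

/-+-frac : ∀ t y d e {N} .{{_ : NonZero N}} → d * e ≡ N → ℤ.+ t / N ℚ.+ frac y d ≡ ℤ.+ (t + y * e) / N
/-+-frac t y (suc d) e refl =
  trans (/-+ t y M D) (/-cross (ℤ.+ (t * D + y * M)) (ℤ.+ (t + y * e)) (M * D) M {{m*n≢0 M D}} cross)
  where
  D = suc d
  M = D * e
  identity : ∀ t y d e → (t * d + y * (d * e)) * (d * e) ≡ (t + y * e) * (d * e * d)
  identity = ℕ-solve-∀
  cross : ℤ.+ (t * D + y * M) ℤ.* ℤ.+ M ≡ ℤ.+ (t + y * e) ℤ.* ℤ.+ (M * D)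
  cross = trans (sym (ℤ.pos-* (t * D + y * M) M)) (trans (cong ℤ.+_ (identity t y D e)) (ℤ.pos-* (t + y * e) (M * D)))

↧ₙ[t/N]≡1⇔N∣t : ∀ t N .{{_ : NonZero N}} → ℚ.↧ₙ (ℤ.+ t / N) ≡ 1 ⇔ N ∣ t
↧ₙ[t/N]≡1⇔N∣t t N = mk⇔
  (λ ↧≡1 → subst (_∣ t) (trans (sym (*-identityˡ _)) (trans (cong (_* gcd t N) (sym ↧≡1)) ↧*gcd≡N)) (gcd[m,n]∣m t N))
  (λ N∣t → *-cancelʳ-≡ _ 1 N (trans (cong (↧ *_) (sym (gcd≡N N∣t))) (trans ↧*gcd≡N (sym (*-identityˡ N)))))
  where
  ↧ = ℚ.↧ₙ (ℤ.+ t / N)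
  ↧*gcd≡N : ↧ * gcd t N ≡ N
  ↧*gcd≡N = ℤ.+-injective (trans (ℤ.pos-* ↧ (gcd t N)) (ℚ.↧-/ (ℤ.+ t) N))
  gcd≡N : N ∣ t → gcd t N ≡ N
  gcd≡N N∣t = ∣-antisym (gcd[m,n]∣n t N) (gcd-greatest N∣t ∣-refl)

module _ {b p} {B : Set b} {P : Pred B p} (P? : Decidable P) where

  length-filter-map : ∀ {a} {A : Set a} (g : A → B) xs → length (filter P? (map g xs)) ≡ length (filter (P? ∘ g) xs)
  length-filter-map g []       = refl
  length-filter-map g (x ∷ xs) with does (P? (g x))
  ... | true  = cong suc (length-filter-map g xs)
  ... | false = length-filter-map g xs

  filter-∘-cong : ∀ {a} {A : Set a} {f g : A → B} → (∀ x → f x ≡ g x) → ∀ xs → filter (P? ∘ f) xs ≡ filter (P? ∘ g) xs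
  filter-∘-cong f≗g = filter-≐ (P? ∘ _) (P? ∘ _) ((λ {x} → subst P (f≗g x)) , (λ {x} → subst P (sym (f≗g x))))

  +-length-filter-concatMap : ∀ {a} {A : Set a} (f : A → List B) xs →
    ℤ.+ length (filter P? (concatMap f xs)) ≡ foldr ℤ._+_ 0ℤ (map (λ x → ℤ.+ length (filter P? (f x))) xs)
  +-length-filter-concatMap f []       = refl
  +-length-filter-concatMap f (x ∷ xs) = begin
    ℤ.+ length (filter P? (f x ++ concatMap f xs))
      ≡⟨ cong (ℤ.+_ ∘ length) (filter-++ P? (f x) _) ⟩
    ℤ.+ length (filter P? (f x) ++ filter P? (concatMap f xs))
      ≡⟨ cong ℤ.+_ (length-++ (filter P? (f x))) ⟩
    ℤ.+ (length (filter P? (f x)) + length (filter P? (concatMap f xs)))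
      ≡⟨ ℤ.pos-+ (length (filter P? (f x))) _ ⟩
    ℤ.+ length (filter P? (f x)) ℤ.+ ℤ.+ length (filter P? (concatMap f xs))
      ≡⟨ cong (λ z → ℤ.+ length (filter P? (f x)) ℤ.+ z) (+-length-filter-concatMap f xs) ⟩
    ℤ.+ length (filter P? (f x)) ℤ.+ foldr ℤ._+_ 0ℤ (map (λ x → ℤ.+ length (filter P? (f x))) xs)
      ∎
    where open ≡-Reasoning

  +-length-filter-singleton : ∀ x {q} {Q : Set q} (Q? : Dec Q) → P x ⇔ Q →
    ℤ.+ length (filter P? (x ∷ [])) ≡ (if does Q? then 1ℤ else 0ℤ)
  +-length-filter-singleton x Q? Px⇔Q with P? x | Q?
  ... | yes _  | yes _  = refl
  ... | yes Px | no ¬Q  = contradiction (Equivalence.to Px⇔Q Px) ¬Q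
  ... | no ¬Px | yes Q  = contradiction (Equivalence.from Px⇔Q Q) ¬Px
  ... | no _   | no _   = refl

module Tuples (N : ℕ) .{{_ : NonZero N}} where
  open Solutions N

  cofactors : ∀ {s} (ds : Vec ℕ s) → (∀ i → lookup ds i ∣ N) → Vec (ℕ × ℕ) s
  cofactors []       _ = []
  cofactors (d ∷ ds) h = (d , quotient (h zero)) ∷ cofactors ds (h ∘ suc)

  cofactors-complementary : ∀ {s} (ds : Vec ℕ s) h → All Complementary (cofactors ds h)
  cofactors-complementary []       _ = []
  cofactors-complementary (d ∷ ds) h = sym (m∣n⇒n≡m*quotient (h zero)) ∷ cofactors-complementary ds (h ∘ suc)

  offsetFracSum : ∀ {s} → ℕ → Vec ℕ s → Vec ℕ s → ℚ
  offsetFracSum t ds ys = ℤ.+ t / N ℚ.+ fracSum ys ds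

  offsetFracSum-∷ : ∀ {s} t y d (ds ys : Vec ℕ s) (h : d ∣ N) →
    offsetFracSum t (d ∷ ds) (y ∷ ys) ≡ offsetFracSum (t + y * quotient h) ds ys
  offsetFracSum-∷ t y d ds ys h = trans (sym (ℚ.+-assoc (ℤ.+ t / N) (frac y d) (fracSum ys ds)))
    (cong (ℚ._+ fracSum ys ds) (/-+-frac t y d (quotient h) (sym (m∣n⇒n≡m*quotient h))))

  length-integral≡solutions : ∀ {s} (ds : Vec ℕ s) h t →
    ℤ.+ length (filter (isIntegral? ∘ offsetFracSum t ds) (tuples ds)) ≡ solutions (cofactors ds h) t
  length-integral≡solutions [] h t =
    +-length-filter-singleton {P = λ ys → ℚ.↧ₙ (offsetFracSum t [] ys) ≡ 1} (isIntegral? ∘ offsetFracSum t []) [] (N ∣? t)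
      (subst (λ r → ℚ.↧ₙ r ≡ 1 ⇔ N ∣ t) (sym (ℚ.+-identityʳ (ℤ.+ t / N))) (↧ₙ[t/N]≡1⇔N∣t t N))
  length-integral≡solutions (d ∷ ds) h t = begin
    ℤ.+ length (filter P? (concatMap (λ y → map (y ∷_) (tuples ds)) (applyUpTo suc (d ∸ 1))))
      ≡⟨ +-length-filter-concatMap P? (λ y → map (y ∷_) (tuples ds)) (applyUpTo suc (d ∸ 1)) ⟩
    foldr ℤ._+_ 0ℤ (map (λ y → ℤ.+ length (filter P? (map (y ∷_) (tuples ds)))) (applyUpTo suc (d ∸ 1)))
      ≡⟨ cong (foldr ℤ._+_ 0ℤ) (map-applyUpTo suc _ (d ∸ 1)) ⟩
    ∑[ y < d ∸ 1 ] (ℤ.+ length (filter P? (map (suc y ∷_) (tuples ds))))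
      ≡⟨ ∑-cong (d ∸ 1) (λ y → cong ℤ.+_ (trans (length-filter-map P? (suc y ∷_) (tuples ds))
           (cong length (filter-∘-cong isIntegral? (λ ys → offsetFracSum-∷ t (suc y) d ds ys (h zero)) (tuples ds))))) ⟩
    ∑[ y < d ∸ 1 ] (ℤ.+ length (filter (isIntegral? ∘ offsetFracSum (t + suc y * e) ds) (tuples ds)))
      ≡⟨ ∑-cong (d ∸ 1) (λ y → length-integral≡solutions ds (h ∘ suc) (t + suc y * e)) ⟩
    solutions (cofactors (d ∷ ds) h) t
      ∎
    where
    open ≡-Reasoning
    e = quotient (h zero)
    P? = isIntegral? ∘ offsetFracSum t (d ∷ ds)

  I≡solutions : ∀ {s} (ds : Vec ℕ s) h → ℤ.+ I ds ≡ solutions (cofactors ds h) 0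
  I≡solutions ds h = trans
    (cong (ℤ.+_ ∘ length) (filter-∘-cong isIntegral? 0+fracSum (tuples ds)))
    (length-integral≡solutions ds h 0)
    where
    0+fracSum : ∀ ys → fracSum ys ds ≡ offsetFracSum 0 ds ys
    0+fracSum ys = sym (trans (cong (ℚ._+ fracSum ys ds) (ℚ.0/n≡0 N)) (ℚ.+-identityˡ (fracSum ys ds)))

  characterSum-cofactors : ∀ {s} (ds : Vec ℕ s) h m → characterSum (cofactors ds h) m ≡ -[1+ 0 ] ℤ.^ s ℤ.* prodDiv ds m
  characterSum-cofactors []       h m = refl
  characterSum-cofactors {suc s} (d ∷ ds) h m = trans
    (cong ((subgroupSum d m ℤ.- 1ℤ) ℤ.*_) (characterSum-cofactors ds (h ∘ suc) m))
    (flip-sign (does (d ∣? m)) (-[1+ 0 ] ℤ.^ s) (prodDiv ds m))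
    where
    flip-sign : ∀ b σ P → ((if b then ℤ.+ d else 0ℤ) ℤ.- 1ℤ) ℤ.* (σ ℤ.* P)
                        ≡ (-[1+ 0 ] ℤ.* σ) ℤ.* ((if b then 1ℤ ℤ.- ℤ.+ d else 1ℤ) ℤ.* P)
    flip-sign true  σ P = negate-both (ℤ.+ d) σ P
      where
      negate-both : ∀ x σ P → (x ℤ.- 1ℤ) ℤ.* (σ ℤ.* P) ≡ (-[1+ 0 ] ℤ.* σ) ℤ.* ((1ℤ ℤ.- x) ℤ.* P)
      negate-both = solve-∀
    flip-sign false σ P = negate-both σ P
      where
      negate-both : ∀ σ P → (0ℤ ℤ.- 1ℤ) ℤ.* (σ ℤ.* P) ≡ (-[1+ 0 ] ℤ.* σ) ℤ.* (1ℤ ℤ.* P)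
      negate-both = solve-∀

  I-formula : ∀ {s} (ds : Vec ℕ s) h → ℤ.+ N ℤ.* ℤ.+ I ds ≡ -[1+ 0 ] ℤ.^ s ℤ.* ∑[ m < N ] prodDiv ds (suc m)
  I-formula {s} ds h = begin
    ℤ.+ N ℤ.* ℤ.+ I ds
      ≡⟨ cong (ℤ.+ N ℤ.*_) (trans (I≡solutions ds h) (sym (ℤ.+-identityʳ _))) ⟩
    ℤ.+ N ℤ.* ∑[ y < 1 ] solutions cs (y * N)
      ≡⟨ subgroupFormula cs (cofactors-complementary ds h) 1 N (*-identityˡ N) ⟩
    ∑[ m < N ] (subgroupSum 1 (suc m) ℤ.* characterSum cs (suc m))
      ≡⟨ ∑-cong N (λ m → trans (cong (ℤ._* characterSum cs (suc m)) (subgroupSum-∣ (1∣ suc m)))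
                               (trans (ℤ.*-identityˡ _) (characterSum-cofactors ds h (suc m)))) ⟩
    ∑[ m < N ] (-[1+ 0 ] ℤ.^ s ℤ.* prodDiv ds (suc m))
      ≡⟨ *-distribˡ-∑ N (-[1+ 0 ] ℤ.^ s) _ ⟨
    -[1+ 0 ] ℤ.^ s ℤ.* ∑[ m < N ] prodDiv ds (suc m)
      ∎
    where
    open ≡-Reasoning
    cs = cofactors ds h

rhsSum≡∑ : ∀ {s} (ds : Vec ℕ s) q → rhsSum ds q ≡ ∑[ m < q ∸ 1 ] prodDiv ds (suc m)
rhsSum≡∑ ds q = cong (foldr ℤ._+_ 0ℤ) (map-applyUpTo suc (prodDiv ds) (q ∸ 1))

lemma2p8 : (p k q s : ℕ) → Prime p → p ≢ 2 → k ≥ 1 → q ≡ p ^ k →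
    .{{_ : NonZero (q ∸ 1)}} →
    (ds : Vec ℕ s) → (∀ (i : Fin s) → lookup ds i ≥ 1) →
    (∀ (i : Fin s) → lookup ds i ∣ (q ∸ 1)) →
    (ℤ.+ I ds) / 1 ≡ ((-[1+ 0 ] ℤ.^ s) ℤ.* rhsSum ds q) / (q ∸ 1)
lemma2p8 p k q s _ _ _ _ ds _ h = /-cross (ℤ.+ I ds) (σ ℤ.* rhsSum ds q) 1 (q ∸ 1) (begin
  ℤ.+ I ds ℤ.* ℤ.+ (q ∸ 1)                   ≡⟨ ℤ.*-comm (ℤ.+ I ds) _ ⟩
  ℤ.+ (q ∸ 1) ℤ.* ℤ.+ I ds                   ≡⟨ I-formula ds h ⟩
  σ ℤ.* ∑[ m < q ∸ 1 ] prodDiv ds (suc m)    ≡⟨ cong (σ ℤ.*_) (rhsSum≡∑ ds q) ⟨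
  σ ℤ.* rhsSum ds q                          ≡⟨ ℤ.*-identityʳ (σ ℤ.* rhsSum ds q) ⟨
  σ ℤ.* rhsSum ds q ℤ.* ℤ.+ 1                ∎)
  where
  open ≡-Reasoning
  open Tuples (q ∸ 1)
  σ = -[1+ 0 ] ℤ.^ s
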